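{- Let $n,k,g$ be integers with $2\leq k\leq n-1$ and $n-k\leq g\leq n-2$. Then, under both the PMC model and the MM$^*$ model, the $g$-good-neighbor conditional diagnosability of the $(n,k)$-star graph satisfies $t_g(S_{n,k})\leq \dfrac{(g+1)!(n-g)}{(n-k)!}-1$.
   Context: For integers $1\leq k\leq n$, let $I_n=\{1,\ldots,n\}$ and let $P(n,k)$ be the set of sequences $p_1\ldots p_k$ of pairwise distinct elements of $I_n$. The $(n,k)$-star graph $S_{n,k}$ has vertex set $P(n,k)$, and $p=p_1p_2\ldots p_k$ is adjacent to $q$ iff either $q$ is obtained from $p$ by swapping $p_1$ and $p_i$ for some $i\in\{2,\ldots,k\}$, or $q=p_1'p_2\ldots p_k$ with $p_1'\in I_n\setminus\{p_1,\ldots,p_k\}$. It is $(n-1)$-regular. Let $G=(V,E)$ be a graph. A set $F\subseteq V$ is a $g$-good-neighbor conditional faulty set if every vertex $v\in V\setminus F$ has at least $g$ neighbors in $V\setminus F$. For $F_1,F_2\subseteq V$, $F_1\triangle F_2=(F_1\setminus F_2)\cup(F_2\setminus F_1)$. PMC model: each vertex $u$ tests each neighbor $v$; the outcome is $0$ if $u,v$ are both fault-free, $1$ if $u$ is fault-free and $v$ faulty, and arbitrary if $u$ is faulty. MM$^*$ model: each vertex $w$ compares every pair $u,v$ of its neighbors; the outcome is $0$ if $u,v,w$ are fault-free, $1$ if $w$ is fault-free and at least one of $u,v$ is faulty, arbitrary if $w$ is faulty. A syndrome is the collection of all outcomes; two distinct sets $F_1,F_2$ are indistinguishable if some syndrome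 can be produced both with fault set $F_1$ and with fault set $F_2$, otherwise distinguishable. Equivalently: under PMC, $F_1,F_2$ are distinguishable iff there is an edge $uv$ with $u\in V\setminus(F_1\cup F_2)$ and $v\in F_1\triangle F_2$; under MM$^*$, they are distinguishable iff (1) there are $u,w\in V\setminus(F_1\cup F_2)$ and $v\in F_1\triangle F_2$ with $uv,uw\in E$, or (2) there are $u,v\in F_1\setminus F_2$ and $w\in V\setminus(F_1\cup F_2)$ with $uw,vw\in E$, or (3) the same as (2) with $F_2\setminus F_1$ in place of $F_1\setminus F_2$. $G$ is $g$-good-neighbor conditionally $t$-diagnosable (under a model) if every two distinct $g$-good-neighbor conditional faulty sets $F_1,F_2$ with $|F_1|,|F_2|\leq t$ are distinguishable; the $g$-good-neighbor conditional diagnosability $t_g(G)$ is the maximum such $t$. -}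

module Defs where

open import Data.Nat using (ℕ; zero; suc; _+_; _*_; _∸_; _≤_; _/_; _!)
open import Data.Nat.Properties using (_!≢0)
open import Data.Fin using (Fin; toℕ)
open import Data.Vec using (Vec; lookup; _[_]≔_)
open import Data.List using (List; length)
open import Data.List.Membership.Propositional using (_∈_; _∉_)
open import Data.List.Relation.Unary.All using (All)
open import Data.List.Relation.Unary.Unique.Propositional using (Unique)
open import Data.Product using (Σ; ∃; ∃-syntax; _×_)
open import Data.Sum using (_⊎_)
open import Relation.Binary.PropositionalEquality using (_≡_; _≢_)
open import Relation.Nullary using (¬_)

record Graph : Set₁ where
  field
    V     : Set
    IsV   : V → Set
    Adj   : V → V → Set

module _ (G : Graph) where
  open Graph G

  VSet : List V → Set
  VSet F = All IsV F × Unique F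

  SameSet : List V → List V → Set
  SameSet F₁ F₂ = ∀ x → (x ∈ F₁ → x ∈ F₂) × (x ∈ F₂ → x ∈ F₁)

  GoodNeighborFaulty : ℕ → List V → Set
  GoodNeighborFaulty g F =
    VSet F ×
    (∀ v → IsV v → v ∉ F →
       Σ (List V) λ L → g ≤ length L × Unique L ×
         All (λ w → IsV w × Adj v w × w ∉ F) L)

  FaultFree : List V → List V → V → Set
  FaultFree F₁ F₂ u = IsV u × u ∉ F₁ × u ∉ F₂

  InSymDiff : List V → List V → V → Set
  InSymDiff F₁ F₂ v = (v ∈ F₁ × v ∉ F₂) ⊎ (v ∈ F₂ × v ∉ F₁)

  DistinguishablePMC : List V → List V → Set
  DistinguishablePMC F₁ F₂ =
    ∃[ u ] ∃[ v ] FaultFree F₁ F₂ u × InSymDiff F₁ F₂ v × Adj u v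

  DistinguishableMM : List V → List V → Set
  DistinguishableMM F₁ F₂ =
    (∃[ u ] ∃[ w ] ∃[ v ]
       FaultFree F₁ F₂ u × FaultFree F₁ F₂ w × InSymDiff F₁ F₂ v ×
       Adj u v × Adj u w)
    ⊎ ((∃[ u ] ∃[ v ] ∃[ w ]
       u ≢ v × (u ∈ F₁ × u ∉ F₂) × (v ∈ F₁ × v ∉ F₂) ×
       FaultFree F₁ F₂ w × Adj u w × Adj v w)
    ⊎ (∃[ u ] ∃[ v ] ∃[ w ]
       u ≢ v × (u ∈ F₂ × u ∉ F₁) × (v ∈ F₂ × v ∉ F₁) ×
       FaultFree F₁ F₂ w × Adj u w × Adj v w))

  GoodNeighborDiagnosable : (List V → List V → Set) → ℕ → ℕ → Set
  GoodNeighborDiagnosable Dist g t =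
    ∀ F₁ F₂ → GoodNeighborFaulty g F₁ → GoodNeighborFaulty g F₂ →
      length F₁ ≤ t → length F₂ ≤ t → ¬ SameSet F₁ F₂ → Dist F₁ F₂

  -- t_g(G) ≤ b : every t for which G is g-good-neighbor conditionally
  -- t-diagnosable satisfies t ≤ b (i.e. the maximum such t is ≤ b)
  DiagnosabilityAtMost : (List V → List V → Set) → ℕ → ℕ → Set
  DiagnosabilityAtMost Dist g b = ∀ t → GoodNeighborDiagnosable Dist g t → t ≤ b

-- The (n,k)-star graph S_{n,k}: vertices are sequences p₁…p_k of pairwise
-- distinct elements of {1..n} (here Fin n, position 1 is index with toℕ = 0).

Distinct : ∀ {n k} → Vec (Fin n) k → Set
Distinct {n} {k} p = ∀ (i j : Fin k) → lookup p i ≡ lookup p j → i ≡ j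

StarAdj : ∀ {n k} → Vec (Fin n) k → Vec (Fin n) k → Set
StarAdj {n} {k} p q =
  -- swap p₁ with p_i, i ∈ {2..k}
  (∃[ i ] ∃[ j ] toℕ i ≡ 0 × i ≢ j ×
     q ≡ ((p [ i ]≔ lookup p j) [ j ]≔ lookup p i))
  ⊎
  -- replace p₁ by an element not occurring in p
  (∃[ i ] ∃[ a ] toℕ i ≡ 0 × (∀ j → lookup p j ≢ a) × q ≡ (p [ i ]≔ a))

StarGraph : ℕ → ℕ → Graph
StarGraph n k = record
  { V   = Vec (Fin n) k
  ; IsV = Distinct
  ; Adj = StarAdj
  }

starBound : ℕ → ℕ → ℕ → ℕ
starBound n k g = (_/_ ((suc g) ! * (n ∸ g)) ((n ∸ k) !) {{(n ∸ k) !≢0}}) ∸ 1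

{-# OPTIONS --safe #-}
module Submission where

-- Split the symbols into g + 1 low ones and r = n - g - 1 ≥ 1 high ones, and let A be the set of
-- vertices whose last r positions carry the high symbols in a fixed order.  Its other k - r
-- positions form an arrangement of low symbols, so |A| = (g+1)!/(n-k)!, and A induces a
-- g-regular subgraph (swaps of the head with the other front positions, and replacements of the
-- head by the unused, necessarily low, symbols).  The only edges leaving A swap the head with a
-- tail position, so the outer neighbourhood N(A) has r|A| elements.  Take F₁ = N(A) and
-- F₂ = A ∪ N(A): they differ exactly on A, and no vertex outside F₂ is adjacent to A, so no
-- test or comparison by a fault-free vertex separates them, in the PMC model or the MM* model.
-- Both are g-good-neighbour: a vertex of A keeps its g neighbours in A, and a vertex outside
-- A ∪ N(A) has no neighbour in A and at most one in N(A), hence at least n - 2 ≥ g fault-free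
-- neighbours.  As |F₂| = (g+1)!(n-g)/(n-k)!, this gives t_g ≤ |F₂| - 1.

open import Defs
open import Data.Empty using (⊥-elim)
open import Data.Fin as Fin using (Fin; zero; suc; _↑ˡ_; _↑ʳ_; splitAt; _≟_)
open import Data.Fin.Permutation.Components using (transpose; transpose-inverse)
open import Data.Fin.Properties
  using (splitAt-↑ˡ; splitAt-↑ʳ; 0≢1+n; suc-injective; ↑ˡ-injective; ↑ʳ-injective; any?; all?)
open import Data.List as List
  using (List; []; _∷_; [_]; length; map; filter; concatMap; cartesianProductWith; allFin)
open import Data.List.Properties
  using (length-++; length-map; length-tabulate; length-removeAt′; filter-accept; filter-reject; filter-all)
open import Data.List.Membership.Propositional using (_∈_; _∉_; _─_; find; lose)
open import Data.List.Membership.Propositional.Properties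
  using ( ∈-map⁺; ∈-map⁻; ∈-filter⁺; ∈-filter⁻; ∈-concatMap⁺; ∈-concatMap⁻; ∈-allFin
        ; ∈-++⁺ˡ; ∈-++⁺ʳ; ∈-++⁻; ∈-cartesianProductWith⁺; ∈-cartesianProductWith⁻)
open import Data.List.Relation.Binary.Disjoint.Propositional using (Disjoint)
open import Data.List.Relation.Binary.Subset.Propositional using (_⊆_)
open import Data.List.Relation.Unary.All as All using (All; []; _∷_)
import Data.List.Relation.Unary.All.Properties as All
open import Data.List.Relation.Unary.AllPairs as AllPairs using ([]; _∷_)
import Data.List.Relation.Unary.AllPairs.Properties as AllPairs
open import Data.List.Relation.Unary.Any using (here; there; index)
open import Data.List.Relation.Unary.Unique.Propositional using (Unique)
import Data.List.Relation.Unary.Unique.Propositional.Properties as Unique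
open import Data.Nat using (ℕ; zero; suc; _+_; _*_; _∸_; _≤_; _<_; _≤?_; z≤n; s≤s; pred; _!; _/_)
open import Data.Nat.Combinatorics.Base using (_P′_)
open import Data.Nat.Combinatorics.Specification using (nP′k≡n!/[n∸k]!; nP′k≡n[n∸1P′k∸1])
open import Data.Nat.DivMod using (/-congˡ; /-congʳ; *-/-assoc)
open import Data.Nat.Divisibility using (m≤n⇒m!∣n!)
open import Data.Nat.Properties
  using ( +-suc; +-comm; *-comm; *-suc; 0∸n≡0; m∸n≤m; m<n⇒0<n∸m; <⇒≤; *-mono-≤; _!≢0
        ; ≤-trans; ≤-reflexive; ≰⇒>; n≤1+n; m≤m+n; m≤n+m; m≤n+m∸n
        ; m+n∸m≡n; m+[n∸m]≡n; m≤n⇒∃[o]m+o≡n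
        ; +-cancelˡ-≤; +-cancelʳ-≤; +-cancelʳ-≡; +-monoˡ-≤; +-monoʳ-≤; module ≤-Reasoning)
open import Data.Nat.Tactic.RingSolver using (solve-∀)
open import Data.Product using (Σ; ∃; ∃₂; _×_; _,_; proj₁; proj₂)
open import Data.Sum using (_⊎_; inj₁; inj₂)
open import Data.Vec as Vec using (Vec; []; _∷_; lookup; _[_]≔_; tabulate; _++_)
open import Data.Vec.Properties
  using ( ∷-injectiveˡ; ∷-injectiveʳ; ++-injectiveˡ; lookup∘update; lookup∘update′; lookup∘tabulate
        ; tabulate∘lookup; tabulate-cong; lookup-++ˡ; lookup-++ʳ; ≡-dec)
open import Function using (_∘_)
open import Level using (0ℓ)
open import Relation.Binary.Definitions using (DecidableEquality)
open import Relation.Binary.PropositionalEquality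
  using (_≡_; _≢_; refl; sym; trans; cong; cong₂; subst; module ≡-Reasoning)
open import Relation.Nullary using (¬_; Dec; yes; no; ¬?)
open import Relation.Unary using (Pred; Decidable)
open import Relation.Unary.Properties using (∁?)

module _ {A : Set} where

  length-filter-∁ : ∀ {P : Pred A 0ℓ} (P? : Decidable P) xs →
    length (filter P? xs) + length (filter (∁? P?) xs) ≡ length xs
  length-filter-∁ P? [] = refl
  length-filter-∁ P? (x ∷ xs) with P? x
  ... | yes _ = cong suc (length-filter-∁ P? xs)
  ... | no _  = trans (+-suc _ _) (cong suc (length-filter-∁ P? xs))

  ∈-─ : ∀ {x z : A} {xs} (x∈xs : x ∈ xs) → z ∈ xs → z ≢ x → z ∈ xs ─ x∈xs
  ∈-─ (here refl)  (here refl)  z≢x = ⊥-elim (z≢x refl)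
  ∈-─ (here refl)  (there z∈xs) _   = z∈xs
  ∈-─ (there _)    (here refl)  _   = here refl
  ∈-─ (there x∈xs) (there z∈xs) z≢x = there (∈-─ x∈xs z∈xs z≢x)

  Unique-⊆⇒length-≤ : ∀ {xs ys : List A} → Unique xs → xs ⊆ ys → length xs ≤ length ys
  Unique-⊆⇒length-≤ {[]}     _            _     = z≤n
  Unique-⊆⇒length-≤ {x ∷ xs} {ys} (x∉xs ∷ u) xs⊆ys = begin
    suc (length xs)          ≤⟨ s≤s (Unique-⊆⇒length-≤ u xs⊆ys─x) ⟩
    suc (length (ys ─ x∈ys)) ≡⟨ length-removeAt′ ys (index x∈ys) ⟨
    length ys                ∎
    where
    open ≤-Reasoning
    x∈ys = xs⊆ys (here refl)
    xs⊆ys─x : xs ⊆ ys ─ x∈ys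
    xs⊆ys─x z∈xs = ∈-─ x∈ys (xs⊆ys (there z∈xs)) (λ z≡x → All.lookup x∉xs z∈xs (sym z≡x))

  0<length⇒∃∈ : ∀ {xs : List A} → 0 < length xs → ∃ (_∈ xs)
  0<length⇒∃∈ {x ∷ _} _ = x , here refl

  Unique∧≡⇒length≤1 : ∀ {xs : List A} → Unique xs → (∀ {x y} → x ∈ xs → y ∈ xs → x ≡ y) →
    length xs ≤ 1
  Unique∧≡⇒length≤1 {[]}    _ _  = z≤n
  Unique∧≡⇒length≤1 {x ∷ _} u eq = Unique-⊆⇒length-≤ {ys = [ x ]} u (λ y∈ → here (eq y∈ (here refl)))

  length-concatMap : ∀ {B : Set} (f : A → List B) {c} xs →
    (∀ {x} → x ∈ xs → length (f x) ≡ c) → length (concatMap f xs) ≡ length xs * c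
  length-concatMap f []       _  = refl
  length-concatMap f (x ∷ xs) eq = trans (length-++ (f x))
    (cong₂ _+_ (eq (here refl)) (length-concatMap f xs (eq ∘ there)))

  length-cartesianProductWith : ∀ {B C : Set} (f : A → B → C) xs ys →
    length (cartesianProductWith f xs ys) ≡ length xs * length ys
  length-cartesianProductWith f []       ys = refl
  length-cartesianProductWith f (x ∷ xs) ys = trans (length-++ (map (f x) ys))
    (cong₂ _+_ (length-map (f x) ys) (length-cartesianProductWith f xs ys))

P′-suc : ∀ l m → l * (pred l P′ m) ≡ l P′ suc m
P′-suc zero    m = cong (_* (0 P′ m)) (sym (0∸n≡0 m))
P′-suc (suc l) m = sym (nP′k≡n[n∸1P′k∸1] (suc l) (suc m))

P′-positive : ∀ {l m} → m ≤ l → 0 < l P′ m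
P′-positive {m = zero}  _   = s≤s z≤n
P′-positive {m = suc m} m<l = *-mono-≤ (m<n⇒0<n∸m m<l) (P′-positive (<⇒≤ m<l))

[l!*c]/[l∸m]!≡lP′m*c : ∀ {l m} c → m ≤ l → _/_ (l ! * c) ((l ∸ m) !) {{(l ∸ m) !≢0}} ≡ (l P′ m) * c
[l!*c]/[l∸m]!≡lP′m*c {l} {m} c m≤l = begin
  (l ! * c) / (l ∸ m) !   ≡⟨ /-congˡ (*-comm (l !) c) ⟩
  (c * l !) / (l ∸ m) !   ≡⟨ *-/-assoc c (m≤n⇒m!∣n! (m∸n≤m l m)) ⟩
  c * (l ! / (l ∸ m) !)   ≡⟨ cong (c *_) (nP′k≡n!/[n∸k]! m≤l) ⟨
  c * (l P′ m)            ≡⟨ *-comm c (l P′ m) ⟩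
  (l P′ m) * c            ∎
  where
  open ≡-Reasoning
  instance _ = (l ∸ m) !≢0

module Arrangements {X : Set} (_≟_ : DecidableEquality X) where

  _without_ : List X → X → List X
  S without y = filter (λ z → ¬? (z ≟ y)) S

  arrangements : (m : ℕ) → List X → List (Vec X m)
  arrangements zero    S = [ [] ]
  arrangements (suc m) S = concatMap (λ y → map (y ∷_) (arrangements m (S without y))) S

  IsArrangement : ∀ {m} → List X → Vec X m → Set
  IsArrangement S w = (∀ i → lookup w i ∈ S) × (∀ i j → lookup w i ≡ lookup w j → i ≡ j)

  ∈-without⁻ : ∀ {S y z} → z ∈ S without y → z ∈ S × z ≢ y
  ∈-without⁻ {S} {y} = ∈-filter⁻ (λ z → ¬? (z ≟ y)) {xs = S}

  ∈-without⁺ : ∀ {S y z} → z ∈ S → z ≢ y → z ∈ S without y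
  ∈-without⁺ {y = y} = ∈-filter⁺ (λ z → ¬? (z ≟ y))

  length-without : ∀ {S y} → Unique S → y ∈ S → length S ≡ suc (length (S without y))
  length-without {x ∷ S} (x∉S ∷ _) (here refl) = cong suc (cong length (sym (begin
    (x ∷ S) without x ≡⟨ filter-reject (λ z → ¬? (z ≟ x)) (λ x≢x → x≢x refl) ⟩
    S without x       ≡⟨ filter-all (λ z → ¬? (z ≟ x)) (All.map (λ x≢z z≡x → x≢z (sym z≡x)) x∉S) ⟩
    S                 ∎)))
    where open ≡-Reasoning
  length-without {x ∷ S} {y} (x∉S ∷ u) (there y∈S) = cong suc (trans (length-without u y∈S)
    (cong length (sym (filter-accept (λ z → ¬? (z ≟ y)) (All.lookup x∉S y∈S)))))

  arrangements-sound : ∀ m {S} {w : Vec X m} → w ∈ arrangements m S → IsArrangement S w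
  arrangements-sound zero (here refl) = (λ ()) , (λ ())
  arrangements-sound (suc m) {S} w∈ with find (∈-concatMap⁻ _ {xs = S} w∈)
  ... | y , y∈S , w∈ʸ with ∈-map⁻ (y ∷_) w∈ʸ
  ... | w , w∈ , refl = entries , injective
    where
    rest : IsArrangement (S without y) w
    rest = arrangements-sound m w∈
    entries : ∀ i → lookup (y ∷ w) i ∈ S
    entries zero    = y∈S
    entries (suc i) = proj₁ (∈-without⁻ {S} (proj₁ rest i))
    injective : ∀ i j → lookup (y ∷ w) i ≡ lookup (y ∷ w) j → i ≡ j
    injective zero    zero    _  = refl
    injective zero    (suc j) eq = ⊥-elim (proj₂ (∈-without⁻ {S} (proj₁ rest j)) (sym eq))
    injective (suc i) zero    eq = ⊥-elim (proj₂ (∈-without⁻ {S} (proj₁ rest i)) eq)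
    injective (suc i) (suc j) eq = cong suc (proj₂ rest i j eq)

  arrangements-complete : ∀ m {S} {w : Vec X m} → IsArrangement S w → w ∈ arrangements m S
  arrangements-complete zero    {w = []}    _ = here refl
  arrangements-complete (suc m) {w = y ∷ w} (entries , injective) =
    ∈-concatMap⁺ _ (lose (entries zero) (∈-map⁺ (y ∷_) (arrangements-complete m
      ( (λ i → ∈-without⁺ (entries (suc i)) (λ eq → 0≢1+n (injective zero (suc i) (sym eq))))
      , (λ i j eq → suc-injective (injective (suc i) (suc j) eq)) ))))

  arrangements-unique : ∀ m {S} → Unique S → Unique (arrangements m S)
  arrangements-unique zero    _ = [] ∷ []
  arrangements-unique (suc m) u = Unique.concat⁺
    (All.map⁺ (All.tabulate (λ _ → Unique.map⁺ ∷-injectiveʳ (arrangements-unique m (Unique.filter⁺ _ u)))))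
    (AllPairs.map⁺ (AllPairs.map disjoint u))
    where
    disjoint : ∀ {y y'} → y ≢ y' →
      Disjoint (map (y ∷_) (arrangements m _)) (map (y' ∷_) (arrangements m _))
    disjoint y≢y' (w∈ , w∈') with ∈-map⁻ _ w∈ | ∈-map⁻ _ w∈'
    ... | _ , _ , refl | _ , _ , eq = y≢y' (∷-injectiveˡ eq)

  length-arrangements : ∀ m {S} → Unique S → length (arrangements m S) ≡ length S P′ m
  length-arrangements zero    _ = refl
  length-arrangements (suc m) {S} u = begin
    length (arrangements (suc m) S) ≡⟨ length-concatMap _ S length-part ⟩
    length S * (pred (length S) P′ m) ≡⟨ P′-suc (length S) m ⟩
    length S P′ suc m               ∎
    where
    open ≡-Reasoning
    length-part : ∀ {y} → y ∈ S → length (map (y ∷_) (arrangements m (S without y))) ≡ pred (length S) P′ m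
    length-part {y} y∈S = begin
      length (map (y ∷_) (arrangements m (S without y))) ≡⟨ length-map (Vec._∷_ y) (arrangements m (S without y)) ⟩
      length (arrangements m (S without y))              ≡⟨ length-arrangements m (Unique.filter⁺ _ u) ⟩
      length (S without y) P′ m                          ≡⟨ cong (λ l → pred l P′ m) (length-without u y∈S) ⟨
      pred (length S) P′ m                               ∎

data SplitView (a b : ℕ) : Fin (a + b) → Set where
  left  : (i : Fin a) → SplitView a b (i ↑ˡ b)
  right : (j : Fin b) → SplitView a b (a ↑ʳ j)

splitView : ∀ a b (p : Fin (a + b)) → SplitView a b p
splitView zero    b p       = right p
splitView (suc a) b zero    = left zero
splitView (suc a) b (suc p) with splitView a b p
... | left i  = left (suc i)
... | right j = right j

↑ˡ≢↑ʳ : ∀ {a b} (i : Fin a) (j : Fin b) → i ↑ˡ b ≢ a ↑ʳ j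
↑ˡ≢↑ʳ {a} {b} i j eq with trans (sym (splitAt-↑ˡ a i b)) (trans (cong (splitAt a) eq) (splitAt-↑ʳ a b j))
... | ()

Vec-ext : ∀ {A : Set} {n} {u w : Vec A n} → (∀ i → lookup u i ≡ lookup w i) → u ≡ w
Vec-ext {u = u} {w} eq = trans (sym (tabulate∘lookup u)) (trans (tabulate-cong eq) (tabulate∘lookup w))

module _ {A : Set} {k : ℕ} where

  swapHead : Vec A (suc k) → Fin (suc k) → Vec A (suc k)
  swapHead v q = (v [ zero ]≔ lookup v q) [ q ]≔ lookup v zero

  lookup-swapHead-at : ∀ v q → lookup (swapHead v q) q ≡ lookup v zero
  lookup-swapHead-at v q = lookup∘update q (v [ zero ]≔ lookup v q) (lookup v zero)

  lookup-swapHead-head : ∀ v {q} → q ≢ zero → lookup (swapHead v q) zero ≡ lookup v q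
  lookup-swapHead-head v {q} q≢0 = trans
    (lookup∘update′ (q≢0 ∘ sym) (v [ zero ]≔ lookup v q) (lookup v zero))
    (lookup∘update zero v (lookup v q))

  lookup-swapHead-other : ∀ v {q p} → p ≢ q → p ≢ zero → lookup (swapHead v q) p ≡ lookup v p
  lookup-swapHead-other v {q} p≢q p≢0 = trans
    (lookup∘update′ p≢q (v [ zero ]≔ lookup v q) (lookup v zero))
    (lookup∘update′ p≢0 v (lookup v q))

  lookup-swapHead : ∀ v q p → lookup (swapHead v q) p ≡ lookup v (transpose q zero p)
  lookup-swapHead v q p with p ≟ q
  ... | yes refl = lookup-swapHead-at v p
  ... | no p≢q with p ≟ zero
  ...   | yes refl = lookup-swapHead-head v (p≢q ∘ sym)
  ...   | no p≢0   = lookup-swapHead-other v p≢q p≢0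

  swapHead-involutive : ∀ v {q} → q ≢ zero → swapHead (swapHead v q) q ≡ v
  swapHead-involutive v {q} q≢0 = Vec-ext pointwise
    where
    pointwise : ∀ p → lookup (swapHead (swapHead v q) q) p ≡ lookup v p
    pointwise p with p ≟ q
    ... | yes refl = trans (lookup-swapHead-at (swapHead v p) p) (lookup-swapHead-head v q≢0)
    ... | no p≢q with p ≟ zero
    ...   | yes refl = trans (lookup-swapHead-head (swapHead v q) q≢0) (lookup-swapHead-at v q)
    ...   | no p≢0   = trans (lookup-swapHead-other (swapHead v q) p≢q p≢0) (lookup-swapHead-other v p≢q p≢0)

module _ {n k : ℕ} where

  swapHead-distinct : ∀ (v : Vec (Fin n) (suc k)) q → Distinct v → Distinct (swapHead v q)
  swapHead-distinct v q dv p p' eq = begin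
    p                                          ≡⟨ transpose-inverse zero q ⟨
    transpose zero q (transpose q zero p)      ≡⟨ cong (transpose zero q) (dv _ _ lookups) ⟩
    transpose zero q (transpose q zero p')     ≡⟨ transpose-inverse zero q ⟩
    p'                                         ∎
    where
    open ≡-Reasoning
    lookups = trans (sym (lookup-swapHead v q p)) (trans eq (lookup-swapHead v q p'))

  replaceHead-distinct : ∀ (v : Vec (Fin n) (suc k)) x → Distinct v → (∀ j → lookup v j ≢ x) →
    Distinct (v [ zero ]≔ x)
  replaceHead-distinct (_ ∷ _) _ dv fresh zero    zero     _  = refl
  replaceHead-distinct (_ ∷ _) _ dv fresh zero    (suc p') eq = ⊥-elim (fresh (suc p') (sym eq))
  replaceHead-distinct (_ ∷ _) _ dv fresh (suc p) zero     eq = ⊥-elim (fresh (suc p) eq)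
  replaceHead-distinct (_ ∷ _) _ dv fresh (suc p) (suc p') eq = dv (suc p) (suc p') eq

  StarAdj-sym : ∀ {v w : Vec (Fin n) (suc k)} → Distinct v → StarAdj v w → StarAdj w v
  StarAdj-sym {v} dv (inj₁ (zero , q , _ , 0≢q , refl)) =
    inj₁ (zero , q , refl , 0≢q , sym (swapHead-involutive v (0≢q ∘ sym)))
  StarAdj-sym {v₀ ∷ v'} dv (inj₂ (zero , x , _ , fresh , refl)) =
    inj₂ (zero , v₀ , refl , v₀-fresh , refl)
    where
    v₀-fresh : ∀ j → lookup (x ∷ v') j ≢ v₀
    v₀-fresh zero    eq = fresh zero (sym eq)
    v₀-fresh (suc j) eq with dv (suc j) zero eq
    ... | ()

  StarAdj-distinct : ∀ {v w : Vec (Fin n) (suc k)} → Distinct v → StarAdj v w → Distinct w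
  StarAdj-distinct {v} dv (inj₁ (zero , q , _ , _ , refl))     = swapHead-distinct v q dv
  StarAdj-distinct {v} dv (inj₂ (zero , x , _ , fresh , refl)) = replaceHead-distinct v x dv fresh

  StarAdj-cases : ∀ {v w : Vec (Fin n) (suc k)} → StarAdj v w →
    (∃ λ q → q ≢ zero × w ≡ swapHead v q) ⊎ (∃ λ x → (∀ j → lookup v j ≢ x) × w ≡ v [ zero ]≔ x)
  StarAdj-cases (inj₁ (zero , q , _ , 0≢q , eq)) = inj₁ (q , 0≢q ∘ sym , eq)
  StarAdj-cases (inj₂ (zero , x , _ , fresh , eq)) = inj₂ (x , fresh , eq)

  StarAdj-head-injective : ∀ {v w w' : Vec (Fin n) (suc k)} → Distinct v → StarAdj v w → StarAdj v w' →
    lookup w zero ≡ lookup w' zero → w ≡ w'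
  StarAdj-head-injective {v} dv (inj₁ (zero , q , _ , 0≢q , refl)) (inj₁ (zero , q' , _ , 0≢q' , refl)) eq =
    cong (swapHead v) (dv q q' (trans (sym (lookup-swapHead-head v (0≢q ∘ sym)))
                                 (trans eq (lookup-swapHead-head v (0≢q' ∘ sym)))))
  StarAdj-head-injective {v} dv (inj₁ (zero , q , _ , 0≢q , refl)) (inj₂ (zero , x , _ , fresh , refl)) eq =
    ⊥-elim (fresh q (trans (sym (lookup-swapHead-head v (0≢q ∘ sym))) (trans eq (lookup∘update zero v x))))
  StarAdj-head-injective {v} dv (inj₂ (zero , x , _ , fresh , refl)) (inj₁ (zero , q , _ , 0≢q , refl)) eq =
    ⊥-elim (fresh q (trans (sym (lookup-swapHead-head v (0≢q ∘ sym))) (trans (sym eq) (lookup∘update zero v x))))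
  StarAdj-head-injective {v} dv (inj₂ (zero , x , _ , _ , refl)) (inj₂ (zero , x' , _ , _ , refl)) eq =
    cong (v [ zero ]≔_) (trans (sym (lookup∘update zero v x)) (trans eq (lookup∘update zero v x')))

  occurs? : ∀ (v : Vec (Fin n) (suc k)) x → Dec (∃ λ j → lookup v j ≡ x)
  occurs? v x = any? (λ j → lookup v j ≟ x)

  unused : Vec (Fin n) (suc k) → List (Fin n)
  unused v = filter (∁? (occurs? v)) (allFin n)

  ∈-unused⁻ : ∀ v {x} → x ∈ unused v → ∀ j → lookup v j ≢ x
  ∈-unused⁻ v x∈ j eq = proj₂ (∈-filter⁻ (∁? (occurs? v)) {xs = allFin n} x∈) (j , eq)

  length-unused : ∀ v → n ≤ suc k + length (unused v)
  length-unused v = begin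
    n                                                        ≡⟨ length-tabulate {n = n} (λ x → x) ⟨
    length (allFin n)                                        ≡⟨ length-filter-∁ (occurs? v) (allFin n) ⟨
    length (filter (occurs? v) (allFin n)) + length (unused v) ≤⟨ +-monoˡ-≤ (length (unused v)) used≤k ⟩
    suc k + length (unused v)                                ∎
    where
    open ≤-Reasoning
    used≤k : length (filter (occurs? v) (allFin n)) ≤ suc k
    used≤k = ≤-trans
      (Unique-⊆⇒length-≤ (Unique.filter⁺ (occurs? v) (Unique.allFin⁺ n)) λ x∈ →
        let (j , eq) = proj₂ (∈-filter⁻ (occurs? v) {xs = allFin n} x∈) in
        subst (_∈ map (lookup v) (allFin (suc k))) eq (∈-map⁺ (lookup v) (∈-allFin j)))
      (≤-reflexive (trans (length-map (lookup v) (allFin (suc k))) (length-tabulate {n = suc k} (λ x → x))))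

  neighbours : Vec (Fin n) (suc k) → List (Vec (Fin n) (suc k))
  neighbours v = map (swapHead v ∘ suc) (allFin k) List.++ map (v [ zero ]≔_) (unused v)

  neighbours-adjacent : ∀ v → All (StarAdj v) (neighbours v)
  neighbours-adjacent v = All.tabulate λ w∈ → case (∈-++⁻ (map (swapHead v ∘ suc) (allFin k)) w∈)
    where
    case : ∀ {w} → w ∈ map (swapHead v ∘ suc) (allFin k) ⊎ w ∈ map (v [ zero ]≔_) (unused v) → StarAdj v w
    case (inj₁ w∈) = let (i , _ , eq) = ∈-map⁻ _ w∈ in inj₁ (zero , suc i , refl , (λ ()) , eq)
    case (inj₂ w∈) = let (x , x∈ , eq) = ∈-map⁻ _ w∈ in inj₂ (zero , x , refl , ∈-unused⁻ v x∈ , eq)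

  neighbours-unique : ∀ {v} → Distinct v → Unique (neighbours v)
  neighbours-unique {v} dv = Unique.++⁺
    (Unique.map⁺ swap-injective (Unique.allFin⁺ k))
    (Unique.map⁺ replace-injective (Unique.filter⁺ _ (Unique.allFin⁺ n)))
    disjoint
    where
    swap-injective : ∀ {i i'} → swapHead v (suc i) ≡ swapHead v (suc i') → i ≡ i'
    swap-injective {i} {i'} eq = suc-injective (dv (suc i) (suc i') (trans
      (sym (lookup-swapHead-head v λ ())) (trans (cong (λ w → lookup w zero) eq) (lookup-swapHead-head v λ ()))))
    replace-injective : ∀ {x x'} → v [ zero ]≔ x ≡ v [ zero ]≔ x' → x ≡ x'
    replace-injective {x} {x'} eq =
      trans (sym (lookup∘update zero v x)) (trans (cong (λ w → lookup w zero) eq) (lookup∘update zero v x'))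
    disjoint : ∀ {w} → ¬ (w ∈ map (swapHead v ∘ suc) (allFin k) × w ∈ map (v [ zero ]≔_) (unused v))
    disjoint (w∈ , w∈') with ∈-map⁻ _ w∈ | ∈-map⁻ _ w∈'
    ... | i , _ , refl | x , x∈ , eq = ∈-unused⁻ v x∈ (suc i)
      (trans (sym (lookup-swapHead-head v λ ())) (trans (cong (λ w → lookup w zero) eq) (lookup∘update zero v x)))

  length-neighbours : ∀ v → length (neighbours v) ≡ k + length (unused v)
  length-neighbours v = trans (length-++ (map (swapHead v ∘ suc) (allFin k)))
    (cong₂ _+_ (trans (length-map _ (allFin k)) (length-tabulate {n = k} (λ x → x))) (length-map _ (unused v)))

module _ (G : Graph) where
  open Graph G

  module _ (Adj-sym : ∀ {u v} → IsV u → Adj u v → Adj v u)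
           {F₁ F₂ : List V} (F₁⊆F₂ : F₁ ⊆ F₂)
           (closed : ∀ {a y} → a ∈ F₂ → a ∉ F₁ → Adj a y → y ∈ F₂) where

    private
      ¬FaultFree-adjacent-to-△ : ∀ {u v} → FaultFree G F₁ F₂ u → InSymDiff G F₁ F₂ v → ¬ Adj u v
      ¬FaultFree-adjacent-to-△ _ (inj₁ (v∈F₁ , v∉F₂)) _ = v∉F₂ (F₁⊆F₂ v∈F₁)
      ¬FaultFree-adjacent-to-△ (isV , _ , u∉F₂) (inj₂ (v∈F₂ , v∉F₁)) uv =
        u∉F₂ (closed v∈F₂ v∉F₁ (Adj-sym isV uv))

    closed-difference⇒¬DistinguishablePMC : ¬ DistinguishablePMC G F₁ F₂
    closed-difference⇒¬DistinguishablePMC (_ , _ , u-ok , v∈△ , uv) = ¬FaultFree-adjacent-to-△ u-ok v∈△ uv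

    closed-difference⇒¬DistinguishableMM : ¬ DistinguishableMM G F₁ F₂
    closed-difference⇒¬DistinguishableMM (inj₁ (_ , _ , _ , u-ok , _ , v∈△ , uv , _)) =
      ¬FaultFree-adjacent-to-△ u-ok v∈△ uv
    closed-difference⇒¬DistinguishableMM (inj₂ (inj₁ (_ , _ , _ , _ , (u∈F₁ , u∉F₂) , _))) =
      u∉F₂ (F₁⊆F₂ u∈F₁)
    closed-difference⇒¬DistinguishableMM
      (inj₂ (inj₂ (_ , _ , _ , _ , (u∈F₂ , u∉F₁) , _ , (_ , _ , w∉F₂) , uw , _))) = w∉F₂ (closed u∈F₂ u∉F₁ uw)

  indistinguishable⇒DiagnosabilityAtMost : ∀ {Dist : List V → List V → Set} {g b F₁ F₂} →
    GoodNeighborFaulty G g F₁ → GoodNeighborFaulty G g F₂ → length F₁ ≤ suc b → length F₂ ≤ suc b →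
    ¬ SameSet G F₁ F₂ → ¬ Dist F₁ F₂ → DiagnosabilityAtMost G Dist g b
  indistinguishable⇒DiagnosabilityAtMost {b = b} gF₁ gF₂ |F₁| |F₂| F₁≠F₂ ¬dist t diagnosable with t ≤? b
  ... | yes t≤b = t≤b
  ... | no  t≰b =
    ⊥-elim (¬dist (diagnosable _ _ gF₁ gF₂ (≤-trans |F₁| (≰⇒> t≰b)) (≤-trans |F₂| (≰⇒> t≰b)) F₁≠F₂))

  module _ (_≟ᵥ_ : DecidableEquality V) where
    open import Data.List.Membership.DecPropositional _≟ᵥ_ using (_∈?_)

    fault-free-sublist : ∀ {g v} F (L : List V) c → Unique L → All (λ w → IsV w × Adj v w) L →
      (∀ {L'} → Unique L' → L' ⊆ L → All (_∈ F) L' → length L' ≤ c) → g + c ≤ length L →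
      Σ (List V) λ L' → g ≤ length L' × Unique L' × All (λ w → IsV w × Adj v w × w ∉ F) L'
    fault-free-sublist {g} F L c uL adjL few g+c≤|L| =
      healthy , g≤ , Unique.filter⁺ (∁? (_∈? F)) uL , All.tabulate λ w∈ →
        let (w∈L , w∉F) = ∈-filter⁻ (∁? (_∈? F)) {xs = L} w∈ in
        proj₁ (All.lookup adjL w∈L) , proj₂ (All.lookup adjL w∈L) , w∉F
      where
      faulty healthy : List V
      faulty  = filter (_∈? F) L
      healthy = filter (∁? (_∈? F)) L
      |faulty|≤c : length faulty ≤ c
      |faulty|≤c = few (Unique.filter⁺ (_∈? F) uL) (λ w∈ → proj₁ (∈-filter⁻ (_∈? F) {xs = L} w∈))
        (All.tabulate λ w∈ → proj₂ (∈-filter⁻ (_∈? F) {xs = L} w∈))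
      g≤ : g ≤ length healthy
      g≤ = +-cancelʳ-≤ c g (length healthy) (begin
        g + c                                 ≤⟨ g+c≤|L| ⟩
        length L                              ≡⟨ length-filter-∁ (_∈? F) L ⟨
        length faulty + length healthy        ≤⟨ +-monoˡ-≤ (length healthy) |faulty|≤c ⟩
        c + length healthy                    ≡⟨ +-comm c (length healthy) ⟩
        length healthy + c                    ∎)
        where open ≤-Reasoning

n-as-k+e : ∀ m' e r' → suc (m' + e) + suc r' ≡ (suc m' + suc r') + e
n-as-k+e = solve-∀

-- Here g = m' + e, e = n - k and r = r' + 1 = n - g - 1, so that n = (g + 1) + r and k = m + r
-- with m = m' + 1 hold definitionally; `block` lists A and `boundary` lists N(A).
module Witness (m' e r' : ℕ) where

  g s r m n k : ℕ
  g = m' + e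
  s = suc g
  r = suc r'
  m = suc m'
  n = s + r
  k = m + r

  Vertex : Set
  Vertex = Vec (Fin n) k

  low : Fin s → Fin n
  low l = l ↑ˡ r

  high : Fin r → Fin n
  high j = s ↑ʳ j

  tailPos : Fin r → Fin k
  tailPos j = m ↑ʳ j

  highTail : Vec (Fin n) r
  highTail = tabulate high

  lows : List (Fin n)
  lows = map low (allFin s)

  InBlock : Vertex → Set
  InBlock w = Distinct w × (∀ j → lookup w (tailPos j) ≡ high j)

  InBoundary : Vertex → Set
  InBoundary x = ∃₂ λ a j → InBlock a × x ≡ swapHead a (tailPos j)

  open Arrangements (Fin._≟_ {n})

  blockVertex : Vec (Fin n) m → Vertex
  blockVertex u = u ++ highTail

  boundaryVertex : Vec (Fin n) m → Fin r → Vertex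
  boundaryVertex u j = swapHead (blockVertex u) (tailPos j)

  block boundary : List Vertex
  block    = map blockVertex (arrangements m lows)
  boundary = cartesianProductWith boundaryVertex (arrangements m lows) (allFin r)

  lows-unique : Unique lows
  lows-unique = Unique.map⁺ (λ {l} {l'} → ↑ˡ-injective r l l') (Unique.allFin⁺ s)

  tailPos≢zero : ∀ {j} → tailPos j ≢ zero
  tailPos≢zero ()

  lookup-blockVertex-front : ∀ u i → lookup (blockVertex u) (i ↑ˡ r) ≡ lookup u i
  lookup-blockVertex-front u i = lookup-++ˡ u highTail i

  lookup-blockVertex-tail : ∀ u j → lookup (blockVertex u) (tailPos j) ≡ high j
  lookup-blockVertex-tail u j = trans (lookup-++ʳ u highTail j) (lookup∘tabulate high j)

  non-high⇒∈lows : ∀ x → (∀ j → x ≢ high j) → x ∈ lows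
  non-high⇒∈lows x not-high with splitView s r x
  ... | left l  = ∈-map⁺ low (∈-allFin l)
  ... | right j = ⊥-elim (not-high j refl)

  low≢high : ∀ {x} j → x ∈ lows → x ≢ high j
  low≢high j x∈ eq with ∈-map⁻ low x∈
  ... | l , _ , refl = ↑ˡ≢↑ʳ l j eq

  ∈-block⁻ : ∀ {w} → w ∈ block → InBlock w
  ∈-block⁻ w∈ with ∈-map⁻ blockVertex w∈
  ... | u , u∈ , refl = distinct , lookup-blockVertex-tail u
    where
    entries : ∀ i → lookup u i ∈ lows
    entries = proj₁ (arrangements-sound m {lows} u∈)
    injective : ∀ i i' → lookup u i ≡ lookup u i' → i ≡ i'
    injective = proj₂ (arrangements-sound m {lows} u∈)
    distinct : Distinct (blockVertex u)
    distinct p p' eq with splitView m r p | splitView m r p'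
    ... | left i  | left i'  = cong (_↑ˡ r) (injective i i'
            (trans (sym (lookup-blockVertex-front u i)) (trans eq (lookup-blockVertex-front u i'))))
    ... | right j | right j' = cong (m ↑ʳ_) (↑ʳ-injective s j j'
            (trans (sym (lookup-blockVertex-tail u j)) (trans eq (lookup-blockVertex-tail u j'))))
    ... | left i  | right j' = ⊥-elim (low≢high j' (entries i)
            (trans (sym (lookup-blockVertex-front u i)) (trans eq (lookup-blockVertex-tail u j'))))
    ... | right j | left i'  = ⊥-elim (low≢high j (entries i')
            (trans (sym (lookup-blockVertex-front u i')) (trans (sym eq) (lookup-blockVertex-tail u j))))

  ∈-block⁺ : ∀ {w} → InBlock w → w ∈ block
  ∈-block⁺ {w} (distinct , tail) with Vec.splitAt m w
  ... | u , t , refl = subst (λ t → u ++ t ∈ block) t≡highTail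
      (∈-map⁺ blockVertex (arrangements-complete m (entries , injective)))
    where
    t≡highTail : highTail ≡ t
    t≡highTail = Vec-ext λ j →
      trans (lookup∘tabulate high j) (trans (sym (tail j)) (lookup-++ʳ u t j))
    front : ∀ i → lookup (u ++ t) (i ↑ˡ r) ≡ lookup u i
    front i = lookup-++ˡ u t i
    entries : ∀ i → lookup u i ∈ lows
    entries i = non-high⇒∈lows (lookup u i) λ j eq →
      ↑ˡ≢↑ʳ i j (distinct _ _ (trans (front i) (trans eq (sym (tail j)))))
    injective : ∀ i i' → lookup u i ≡ lookup u i' → i ≡ i'
    injective i i' eq = ↑ˡ-injective r i i' (distinct _ _ (trans (front i) (trans eq (sym (front i')))))

  InBlock-blockVertex : ∀ {u} → u ∈ arrangements m lows → InBlock (blockVertex u)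
  InBlock-blockVertex u∈ = ∈-block⁻ (∈-map⁺ blockVertex u∈)

  ∈-boundary⁻ : ∀ {x} → x ∈ boundary → InBoundary x
  ∈-boundary⁻ x∈ with ∈-cartesianProductWith⁻ boundaryVertex (arrangements m lows) (allFin r) x∈
  ... | u , j , u∈ , _ , refl = blockVertex u , j , InBlock-blockVertex u∈ , refl

  ∈-boundary⁺ : ∀ {x} → InBoundary x → x ∈ boundary
  ∈-boundary⁺ (a , j , a∈ , refl) with ∈-map⁻ blockVertex (∈-block⁺ {a} a∈)
  ... | u , u∈ , refl = ∈-cartesianProductWith⁺ boundaryVertex u∈ (∈-allFin j)

  lookup-swapHead-tail : ∀ (v : Vertex) {i j} → j ≢ i →
    lookup (swapHead v (tailPos i)) (tailPos j) ≡ lookup v (tailPos j)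
  lookup-swapHead-tail v {i} {j} j≢i = lookup-swapHead-other v (j≢i ∘ ↑ʳ-injective m j i) tailPos≢zero

  BoundaryShape : Vertex → Fin r → Set
  BoundaryShape x j = lookup x zero ≡ high j × lookup x (tailPos j) ≢ high j ×
                      (∀ j' → j' ≢ j → lookup x (tailPos j') ≡ high j')

  boundary-shape : ∀ a → InBlock a → ∀ j → BoundaryShape (swapHead a (tailPos j)) j
  boundary-shape a (distinct , tail) j =
    trans (lookup-swapHead-head a tailPos≢zero) (tail j) ,
    (λ eq → tailPos≢zero (sym (distinct zero (tailPos j)
      (trans (sym (lookup-swapHead-at a (tailPos j))) (trans eq (sym (tail j))))))) ,
    (λ j' j'≢j → trans (lookup-swapHead-tail a j'≢j) (tail j'))

  InBlock⇒¬InBoundary : ∀ {x} → InBlock x → ¬ InBoundary x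
  InBlock⇒¬InBoundary (_ , tail) (a , j , a∈ , refl) = proj₁ (proj₂ (boundary-shape a a∈ j)) (tail j)

  head-boundaryVertex : ∀ u j → lookup (boundaryVertex u j) zero ≡ high j
  head-boundaryVertex u j = trans (lookup-swapHead-head (blockVertex u) tailPos≢zero) (lookup-blockVertex-tail u j)

  block-unique : Unique block
  block-unique = Unique.map⁺ (++-injectiveˡ _ _) (arrangements-unique m lows-unique)

  boundary-unique : Unique boundary
  boundary-unique = Unique.cartesianProductWith⁺ boundaryVertex injective
    (arrangements-unique m lows-unique) (Unique.allFin⁺ r)
    where
    injective : ∀ {u u' j j'} → boundaryVertex u j ≡ boundaryVertex u' j' → u ≡ u' × j ≡ j'
    injective {u} {u'} {j} {j'} eq with ↑ʳ-injective s j j' (begin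
      high j                                  ≡⟨ head-boundaryVertex u j ⟨
      lookup (boundaryVertex u j) zero        ≡⟨ cong (λ x → lookup x zero) eq ⟩
      lookup (boundaryVertex u' j') zero      ≡⟨ head-boundaryVertex u' j' ⟩
      high j'                                 ∎)
      where open ≡-Reasoning
    ... | refl = ++-injectiveˡ u u' (begin
      blockVertex u                                     ≡⟨ swapHead-involutive (blockVertex u) tailPos≢zero ⟨
      swapHead (boundaryVertex u j) (tailPos j)         ≡⟨ cong (λ x → swapHead x (tailPos j)) eq ⟩
      swapHead (boundaryVertex u' j) (tailPos j)        ≡⟨ swapHead-involutive (blockVertex u') tailPos≢zero ⟩
      blockVertex u'                                    ∎) , refl
      where open ≡-Reasoning

  swapHead-front-InBlock : ∀ {a} → InBlock a → (i : Fin m) → InBlock (swapHead a (i ↑ˡ r))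
  swapHead-front-InBlock {a} (distinct , tail) i = swapHead-distinct a (i ↑ˡ r) distinct , λ j →
    trans (lookup-swapHead-other a (↑ˡ≢↑ʳ i j ∘ sym) tailPos≢zero) (tail j)

  replaceHead-InBlock : ∀ {a x} → InBlock a → (∀ j → lookup a j ≢ x) → InBlock (a [ zero ]≔ x)
  replaceHead-InBlock {a} {x} (distinct , tail) fresh = replaceHead-distinct a x distinct fresh , λ j →
    trans (lookup∘update′ tailPos≢zero a x) (tail j)

  block-neighbour : ∀ {a y} → InBlock a → StarAdj a y → InBlock y ⊎ ∃ λ j → y ≡ swapHead a (tailPos j)
  block-neighbour {a} a∈ adj with StarAdj-cases adj
  ... | inj₂ (x , fresh , refl) = inj₁ (replaceHead-InBlock {a} a∈ fresh)
  ... | inj₁ (q , _ , refl) with splitView m r q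
  ...   | left i  = inj₁ (swapHead-front-InBlock {a} a∈ i)
  ...   | right j = inj₂ (j , refl)

  block-closed : ∀ {a y} → InBlock a → StarAdj a y → InBlock y ⊎ InBoundary y
  block-closed {a} a∈ adj with block-neighbour a∈ adj
  ... | inj₁ y∈       = inj₁ y∈
  ... | inj₂ (j , eq) = inj₂ (a , j , a∈ , eq)

  -- If v ∉ A is adjacent to the swap of some a ∈ A with tail position j, then j is the only tail
  -- position where v misses its high symbol although that symbol is not v's head.  So v determines
  -- j, hence the head of its neighbour in N(A), hence the neighbour itself.
  Defect : Vertex → Fin r → Set
  Defect v j = lookup v (tailPos j) ≢ high j × lookup v zero ≢ high j

  UniqueDefect : Vertex → Fin r → Set
  UniqueDefect v j = Defect v j × (∀ j' → Defect v j' → j' ≡ j)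

  unique-defect-if-tail-agrees : ∀ {v x j} → BoundaryShape x j →
    (∀ j' → lookup v (tailPos j') ≡ lookup x (tailPos j')) → lookup v zero ≢ high j → UniqueDefect v j
  unique-defect-if-tail-agrees {j = j} (_ , x≢ , x≡) agree v₀≢ =
    ((λ eq → x≢ (trans (sym (agree j)) eq)) , v₀≢) , unique
    where
    unique : ∀ j' → _ → j' ≡ j
    unique j' (v≢ , _) with j' ≟ j
    ... | yes j'≡j = j'≡j
    ... | no  j'≢j = ⊥-elim (v≢ (trans (agree j') (x≡ j' j'≢j)))

  tail-swap-defect : ∀ {v i j} → Distinct v → ¬ InBlock v → BoundaryShape (swapHead v (tailPos i)) j →
    UniqueDefect v j
  tail-swap-defect {v} {i} {j} dv v∉block (x₀ , x≢ , x≡) with i ≟ j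
  ... | yes refl = ⊥-elim (v∉block (dv , tail))
    where
    tail : ∀ j' → lookup v (tailPos j') ≡ high j'
    tail j' with j' ≟ i
    ... | yes refl = trans (sym (lookup-swapHead-head v tailPos≢zero)) x₀
    ... | no j'≢i  = trans (sym (lookup-swapHead-tail v j'≢i)) (x≡ j' j'≢i)
  ... | no i≢j = ((λ eq → x≢ (trans (lookup-swapHead-tail v (i≢j ∘ sym)) eq)) , v₀≢) , unique
    where
    v₀ : lookup v zero ≡ high i
    v₀ = trans (sym (lookup-swapHead-at v (tailPos i))) (x≡ i i≢j)
    v₀≢ : lookup v zero ≢ high j
    v₀≢ eq = i≢j (↑ʳ-injective s i j (trans (sym v₀) eq))
    unique : ∀ j' → Defect v j' → j' ≡ j
    unique j' (v≢ , v₀≢') with j' ≟ i | j' ≟ j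
    ... | yes refl | _        = ⊥-elim (v₀≢' v₀)
    ... | no _     | yes j'≡j = j'≡j
    ... | no j'≢i  | no j'≢j  = ⊥-elim (v≢ (trans (sym (lookup-swapHead-tail v j'≢i)) (x≡ j' j'≢j)))

  boundary-neighbour-defect : ∀ {v x j} → Distinct v → ¬ InBlock v → StarAdj v x → BoundaryShape x j →
    UniqueDefect v j
  boundary-neighbour-defect {v} dv v∉block adj shape@(x₀ , _ , _) with StarAdj-cases adj
  ... | inj₂ (y , fresh , refl) = unique-defect-if-tail-agrees {v} {v [ zero ]≔ y} shape
    (λ j' → sym (lookup∘update′ tailPos≢zero v y))
    (λ eq → fresh zero (trans eq (trans (sym x₀) (lookup∘update zero v y))))
  ... | inj₁ (q , q≢0 , refl) with splitView m r q
  ...   | right i = tail-swap-defect {v} {i} dv v∉block shape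
  ...   | left i  = unique-defect-if-tail-agrees {v} {swapHead v q} shape
    (λ j' → sym (lookup-swapHead-other v (↑ˡ≢↑ʳ i j' ∘ sym) tailPos≢zero))
    (λ eq → q≢0 (swapHead-distinct v q dv q zero (trans (lookup-swapHead-at v q) (trans eq (sym x₀)))))

  boundary-neighbours-equal : ∀ {v x y} → Distinct v → ¬ InBlock v → StarAdj v x → StarAdj v y →
    InBoundary x → InBoundary y → x ≡ y
  boundary-neighbours-equal dv v∉block vx vy (a , j , a∈ , refl) (b , j' , b∈ , refl)
    with boundary-shape a a∈ j | boundary-shape b b∈ j'
  ... | shape@(x₀ , _) | shape'@(y₀ , _)
    with boundary-neighbour-defect dv v∉block vx shape | boundary-neighbour-defect dv v∉block vy shape'
  ... | (_ , unique) | (defect' , _) with unique j' defect'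
  ... | refl = StarAdj-head-injective dv vx vy (trans x₀ (sym y₀))

  G : Graph
  G = StarGraph n k

  tailSwaps : Vertex → List Vertex
  tailSwaps v = map (swapHead v ∘ tailPos) (allFin r)

  n≡k+e : n ≡ k + e
  n≡k+e = n-as-k+e m' e r'

  g+r≤degree : ∀ v → g + r ≤ length (neighbours v)
  g+r≤degree v = begin
    (m' + e) + r                  ≡⟨ rearrange m' e r ⟩
    (m' + r) + e                  ≤⟨ +-monoʳ-≤ (m' + r) e≤|unused| ⟩
    (m' + r) + length (unused v)  ≡⟨ length-neighbours v ⟨
    length (neighbours v)         ∎
    where
    open ≤-Reasoning
    rearrange : ∀ a b c → (a + b) + c ≡ (a + c) + b
    rearrange = solve-∀
    e≤|unused| : e ≤ length (unused v)
    e≤|unused| = +-cancelˡ-≤ k e _ (subst (_≤ k + length (unused v)) n≡k+e (length-unused v))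

  good-neighbours : ∀ F → (∀ {x} → x ∈ F → InBlock x ⊎ InBoundary x) → (∀ {x} → InBoundary x → x ∈ F) →
    (∀ {a} → InBlock a → a ∉ F → ∀ {b} → InBlock b → b ∉ F) →
    ∀ v → Distinct v → v ∉ F →
    Σ (List Vertex) λ L → g ≤ length L × Unique L × All (λ w → Distinct w × StarAdj v w × w ∉ F) L
  good-neighbours F F⊆ boundary⊆F healthy v dv v∉F =
    fault-free-sublist G (≡-dec Fin._≟_) F (neighbours v) r (neighbours-unique dv)
      (All.map (λ vw → StarAdj-distinct dv vw , vw) (neighbours-adjacent v)) few (g+r≤degree v)
    where
    few : ∀ {L} → Unique L → L ⊆ neighbours v → All (_∈ F) L → length L ≤ r
    few {L} uL L⊆ L⊆F with all? (λ j → lookup v (tailPos j) ≟ high j)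
    ... | yes tail = ≤-trans (Unique-⊆⇒length-≤ uL tail-swap)
                             (≤-reflexive (trans (length-map _ (allFin r)) (length-tabulate {n = r} (λ j → j))))
      where
      tail-swap : L ⊆ tailSwaps v
      tail-swap w∈ with block-neighbour (dv , tail) (All.lookup (neighbours-adjacent v) (L⊆ w∈))
      ... | inj₁ w∈block  = ⊥-elim (healthy (dv , tail) v∉F w∈block (All.lookup L⊆F w∈))
      ... | inj₂ (j , eq) = subst (_∈ tailSwaps v) (sym eq) (∈-map⁺ (swapHead v ∘ tailPos) (∈-allFin j))
    ... | no ¬tail = ≤-trans (Unique∧≡⇒length≤1 uL λ x∈ y∈ →
                               boundary-neighbours-equal dv v∉block (adjacent x∈) (adjacent y∈)
                                 (in-boundary x∈) (in-boundary y∈))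
                             (s≤s z≤n)
      where
      v∉block : ¬ InBlock v
      v∉block = ¬tail ∘ proj₂
      adjacent : ∀ {w} → w ∈ L → StarAdj v w
      adjacent w∈ = All.lookup (neighbours-adjacent v) (L⊆ w∈)
      in-boundary : ∀ {w} → w ∈ L → InBoundary w
      in-boundary w∈ with F⊆ (All.lookup L⊆F w∈)
      ... | inj₂ w∈boundary = w∈boundary
      ... | inj₁ w∈block with block-closed w∈block (StarAdj-sym dv (adjacent w∈))
      ...   | inj₁ v∈block    = ⊥-elim (v∉block v∈block)
      ...   | inj₂ v∈boundary = ⊥-elim (v∉F (boundary⊆F v∈boundary))

  boundary-distinct : ∀ {x} → InBoundary x → Distinct x
  boundary-distinct (a , j , (da , _) , refl) = swapHead-distinct a (tailPos j) da

  F₁ F₂ : List Vertex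
  F₁ = boundary
  F₂ = block List.++ boundary

  F₁-faulty : GoodNeighborFaulty G g F₁
  F₁-faulty = (All.tabulate (boundary-distinct ∘ ∈-boundary⁻) , boundary-unique) ,
    good-neighbours F₁ (inj₂ ∘ ∈-boundary⁻) ∈-boundary⁺
      (λ _ _ b∈block b∈F₁ → InBlock⇒¬InBoundary b∈block (∈-boundary⁻ b∈F₁))

  F₂-covered : ∀ {x} → x ∈ F₂ → InBlock x ⊎ InBoundary x
  F₂-covered x∈ with ∈-++⁻ block x∈
  ... | inj₁ x∈block    = inj₁ (∈-block⁻ x∈block)
  ... | inj₂ x∈boundary = inj₂ (∈-boundary⁻ x∈boundary)

  F₂-faulty : GoodNeighborFaulty G g F₂
  F₂-faulty = (All.tabulate distinct , Unique.++⁺ block-unique boundary-unique disjoint) ,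
    good-neighbours F₂ F₂-covered (∈-++⁺ʳ block ∘ ∈-boundary⁺)
      (λ a∈block a∉F₂ → ⊥-elim (a∉F₂ (∈-++⁺ˡ (∈-block⁺ a∈block))))
    where
    distinct : ∀ {x} → x ∈ F₂ → Distinct x
    distinct x∈ with F₂-covered x∈
    ... | inj₁ x∈block    = proj₁ x∈block
    ... | inj₂ x∈boundary = boundary-distinct x∈boundary
    disjoint : ∀ {x} → ¬ (x ∈ block × x ∈ boundary)
    disjoint (x∈block , x∈boundary) = InBlock⇒¬InBoundary (∈-block⁻ x∈block) (∈-boundary⁻ x∈boundary)

  F₂∖F₁-closed : ∀ {a y} → a ∈ F₂ → a ∉ F₁ → StarAdj a y → y ∈ F₂
  F₂∖F₁-closed a∈F₂ a∉F₁ adj with ∈-++⁻ block a∈F₂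
  ... | inj₂ a∈F₁    = ⊥-elim (a∉F₁ a∈F₁)
  ... | inj₁ a∈block with block-closed (∈-block⁻ a∈block) adj
  ...   | inj₁ y∈block    = ∈-++⁺ˡ (∈-block⁺ y∈block)
  ...   | inj₂ y∈boundary = ∈-++⁺ʳ block (∈-boundary⁺ y∈boundary)

  length-arrangements-lows : length (arrangements m lows) ≡ s P′ m
  length-arrangements-lows = trans (length-arrangements m lows-unique)
    (cong (_P′ m) (trans (length-map low (allFin s)) (length-tabulate {n = s} (λ l → l))))

  length-F₂ : length F₂ ≡ (s P′ m) * suc r
  length-F₂ = begin
    length (block List.++ boundary)      ≡⟨ length-++ block ⟩
    length block + length boundary       ≡⟨ cong₂ _+_ (length-map blockVertex arrs)
                                                      (length-cartesianProductWith boundaryVertex arrs (allFin r)) ⟩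
    length arrs + length arrs * length (allFin r)
                                         ≡⟨ cong₂ (λ a b → a + a * b) length-arrangements-lows
                                                  (length-tabulate {n = r} (λ j → j)) ⟩
    (s P′ m) + (s P′ m) * r              ≡⟨ *-suc (s P′ m) r ⟨
    (s P′ m) * suc r                     ∎
    where
    open ≡-Reasoning
    arrs = arrangements m lows

  starBound≡|F₂|∸1 : starBound n k g ≡ length F₂ ∸ 1
  starBound≡|F₂|∸1 = cong (_∸ 1) (begin
    (s ! * (n ∸ g)) / (n ∸ k) !                    ≡⟨ /-congʳ (cong _! n∸k≡s∸m) ⟩
    (s ! * (n ∸ g)) / (s ∸ m) !                    ≡⟨ [l!*c]/[l∸m]!≡lP′m*c (n ∸ g) (s≤s (m≤m+n m' e)) ⟩
    (s P′ m) * (n ∸ g)                            ≡⟨ cong ((s P′ m) *_) n∸g≡suc-r ⟩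
    (s P′ m) * suc r                              ≡⟨ length-F₂ ⟨
    length F₂                                     ∎)
    where
    open ≡-Reasoning
    instance
      _ = (n ∸ k) !≢0
      _ = (s ∸ m) !≢0
    n∸k≡s∸m : n ∸ k ≡ s ∸ m
    n∸k≡s∸m = trans (cong (_∸ k) n≡k+e) (trans (m+n∸m≡n k e) (sym (m+n∸m≡n m' e)))
    n∸g≡suc-r : n ∸ g ≡ suc r
    n∸g≡suc-r = trans (cong (_∸ g) (sym (+-suc g r))) (m+n∸m≡n g (suc r))

  F₁≢F₂ : ¬ SameSet G F₁ F₂
  F₁≢F₂ same with 0<length⇒∃∈ (subst (0 <_) (sym length-arrangements-lows) (P′-positive (s≤s (m≤m+n m' e))))
  ... | u , u∈ = InBlock⇒¬InBoundary (InBlock-blockVertex u∈)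
    (∈-boundary⁻ (proj₂ (same (blockVertex u)) (∈-++⁺ˡ (∈-map⁺ blockVertex u∈))))

  diagnosability-bound : DiagnosabilityAtMost G (DistinguishablePMC G) g (starBound n k g)
                       × DiagnosabilityAtMost G (DistinguishableMM G) g (starBound n k g)
  diagnosability-bound =
    bound (closed-difference⇒¬DistinguishablePMC G StarAdj-sym F₁⊆F₂ F₂∖F₁-closed) ,
    bound (closed-difference⇒¬DistinguishableMM G StarAdj-sym F₁⊆F₂ F₂∖F₁-closed)
    where
    F₁⊆F₂ : F₁ ⊆ F₂
    F₁⊆F₂ = ∈-++⁺ʳ block
    |F₂|≤ : length F₂ ≤ suc (starBound n k g)
    |F₂|≤ = subst (λ b → length F₂ ≤ suc b) (sym starBound≡|F₂|∸1) (m≤n+m∸n (length F₂) 1)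
    |F₁|≤ : length F₁ ≤ suc (starBound n k g)
    |F₁|≤ = ≤-trans (≤-trans (m≤n+m (length boundary) (length block)) (≤-reflexive (sym (length-++ block))))
                    |F₂|≤
    bound : ∀ {Dist} → ¬ Dist F₁ F₂ → DiagnosabilityAtMost G Dist g (starBound n k g)
    bound = indistinguishable⇒DiagnosabilityAtMost G F₁-faulty F₂-faulty |F₁|≤ |F₂|≤ F₁≢F₂

star-parameters : ∀ {n k g} → 2 ≤ k → k ≤ n ∸ 1 → n ∸ k ≤ g → g ≤ n ∸ 2 →
  ∃ λ m' → ∃ λ e → ∃ λ r' → n ≡ suc (m' + e) + suc r' × k ≡ suc m' + suc r' × g ≡ m' + e
star-parameters {zero}        2≤k k≤0 _ _ with ≤-trans 2≤k k≤0
... | ()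
star-parameters {suc zero}    2≤k k≤0 _ _ with ≤-trans 2≤k k≤0
... | ()
star-parameters {n@(suc (suc n''))} {k} {g} _ k≤n∸1 n∸k≤g g≤n∸2
  with m' , e+m'≡g ← m≤n⇒∃[o]m+o≡n n∸k≤g | r' , g+r'≡n'' ← m≤n⇒∃[o]m+o≡n g≤n∸2 =
  m' , e , r' , n≡ , k≡ , g≡
  where
  e = n ∸ k
  g≡ : g ≡ m' + e
  g≡ = trans (sym e+m'≡g) (+-comm e m')
  n≡ : n ≡ suc (m' + e) + suc r'
  n≡ = cong suc (trans (cong suc (sym g+r'≡n'')) (trans (sym (+-suc g r')) (cong (_+ suc r') g≡)))
  k≡ : k ≡ suc m' + suc r'
  k≡ = +-cancelʳ-≡ e k (suc m' + suc r') (begin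
    k + (n ∸ k)              ≡⟨ m+[n∸m]≡n (≤-trans k≤n∸1 (n≤1+n (suc n''))) ⟩
    n                        ≡⟨ n≡ ⟩
    suc (m' + e) + suc r'    ≡⟨ n-as-k+e m' e r' ⟩
    suc m' + suc r' + e      ∎)
    where open ≡-Reasoning

lemma3p2 : ∀ (n k g : ℕ) → 2 ≤ k → k ≤ n ∸ 1 → n ∸ k ≤ g → g ≤ n ∸ 2 →
    DiagnosabilityAtMost (StarGraph n k) (DistinguishablePMC (StarGraph n k)) g (starBound n k g)
    × DiagnosabilityAtMost (StarGraph n k) (DistinguishableMM (StarGraph n k)) g (starBound n k g)
lemma3p2 n k g 2≤k k≤n∸1 n∸k≤g g≤n∸2 with star-parameters 2≤k k≤n∸1 n∸k≤g g≤n∸2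
... | m' , e , r' , refl , refl , refl = Witness.diagnosability-bound m' e r'
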